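{- Let $G$ be a finite group and let $\Sigma=\mathrm{Cay}(G,(T_{i,j})_{4\times 4})$ be a $4$-PGSR of $G$ such that, for some integer $k$ with $2\leq k\leq|G|$: (a) the vertices $(g,1)$ and $(g,2)$ have valency $k+1$ for each $g\in G$; (b) the vertices $(g,3)$ and $(g,4)$ have valency $k$ for each $g\in G$; (c) for each $g\in G$ and $i\in\{1,2,3,4\}$ there is a $3$-cycle of $\Sigma$ through $(g,i)$. Then $G$ has an $m$-HGR for each even integer $m\geq 6$.
   Context: For a finite group $G$ and integer $m\geq1$, let $(T_{i,j})_{m\times m}$ be a matrix of subsets of $G$ with $1\notin T_{i,i}$ and $T_{j,i}=T_{i,j}^{ -1}$ for all $i,j$. The $m$-Cayley graph $\mathrm{Cay}(G,(T_{i,j})_{m\times m})$ has vertex set $G\times\{1,\dots,m\}$ (write $g_i=(g,i)$, $G_i=G\times\{i\}$) and edges $\{g_i,(tg)_j\}$ for all $i,j$, $g\in G$, $t\in T_{i,j}$. An $m$-PGSR of $G$ is such an $m$-Cayley graph with $T_{1,1}=\dots=T_{m,m}=\emptyset$ (not necessarily regular) whose full automorphism group is isomorphic to $G$. For $m\geq2$, an $m$-HGR of $G$ is a regular $m$-partite graph whose automorphism group is isomorphic to $G$ and acts semiregularly on vertices with orbits the parts of the $m$-partition (each part independent); equivalently, a regular $m$-Cayley graph of $G$ with all $T_{i,i}=\emptyset$ whose automorphism group is isomorphic to $G$. -}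

module Defs where

open import Data.Nat using (ℕ; zero; suc; _+_; _≤_)
open import Data.Fin using (Fin)
open import Data.Bool using (Bool; true; false; if_then_else_)
open import Data.List using (List; map; allFin)
open import Data.Nat.ListAction using (sum)
open import Data.Product using (Σ; _×_; _,_)
open import Relation.Binary.PropositionalEquality using (_≡_; _≢_)
open import Algebra.Structures using (IsGroup)

-- A finite group, presented (up to isomorphism) on the carrier Fin order,
-- with propositional equality.
record FinGroup : Set where
  infixl 7 _·_
  field
    order   : ℕ
    _·_     : Fin order → Fin order → Fin order
    e       : Fin order
    inv     : Fin order → Fin order
    isGroup : IsGroup _≡_ _·_ e inv

module _ (G : FinGroup) where
  open FinGroup G

  Subset : Set
  Subset = Fin order → Bool

  Matrix : ℕ → Set
  Matrix m = Fin m → Fin m → Subset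

  IsCayleyMatrix : (m : ℕ) → Matrix m → Set
  IsCayleyMatrix m T =
    ((i : Fin m) → T i i e ≡ false) ×
    ((i j : Fin m) (g : Fin order) → T j i g ≡ T i j (inv g))

  EmptyDiagonal : (m : ℕ) → Matrix m → Set
  EmptyDiagonal m T = (i : Fin m) (g : Fin order) → T i i g ≡ false

  -- Vertices of Cay(G,(T_{i,j})): G × {1..m}, with (g , i) standing for g_i.
  Vertex : ℕ → Set
  Vertex m = Fin order × Fin m

  -- Adjacency: g_i ~ h_j  iff  h = t g for some t ∈ T_{i,j}, i.e. h g⁻¹ ∈ T_{i,j}.
  adj : {m : ℕ} → Matrix m → Vertex m → Vertex m → Bool
  adj T (g , i) (h , j) = T i j (h · inv g)

  valency : {m : ℕ} → Matrix m → Vertex m → ℕ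
  valency {m} T v =
    sum (map (λ j → sum (map (λ h → if adj T v (h , j) then 1 else 0)
                             (allFin order)))
             (allFin m))

  Regular : {m : ℕ} → Matrix m → Set
  Regular {m} T = (u v : Vertex m) → valency T u ≡ valency T v

  HasTriangleThrough : {m : ℕ} → Matrix m → Vertex m → Set
  HasTriangleThrough {m} T v =
    Σ (Vertex m) λ u → Σ (Vertex m) λ w →
      (v ≢ u) × (v ≢ w) × (u ≢ w) ×
      (adj T v u ≡ true) × (adj T u w ≡ true) × (adj T w v ≡ true)

  IsAut : {m : ℕ} → Matrix m → (Vertex m → Vertex m) → Set
  IsAut {m} T f =
    Σ (Vertex m → Vertex m) λ f⁻¹ →
      ((v : Vertex m) → f⁻¹ (f v) ≡ v) ×
      ((v : Vertex m) → f (f⁻¹ v) ≡ v) ×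
      ((u v : Vertex m) → adj T (f u) (f v) ≡ adj T u v)

  -- The full automorphism group Aut(Cay(G,T)) (automorphisms under composition,
  -- compared extensionally) is isomorphic to G: there is a group isomorphism
  -- φ : G → Aut(Cay(G,T)).
  AutIsoG : {m : ℕ} → Matrix m → Set
  AutIsoG {m} T =
    Σ (Fin order → Vertex m → Vertex m) λ φ →
      ((g : Fin order) → IsAut T (φ g)) ×
      ((g h : Fin order) (v : Vertex m) → φ (g · h) v ≡ φ g (φ h v)) ×
      ((g h : Fin order) → ((v : Vertex m) → φ g v ≡ φ h v) → g ≡ h) ×
      ((f : Vertex m → Vertex m) → IsAut T f →
         Σ (Fin order) λ g → (v : Vertex m) → f v ≡ φ g v)

  IsPGSR : (m : ℕ) → Matrix m → Set
  IsPGSR m T = IsCayleyMatrix m T × EmptyDiagonal m T × AutIsoG T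

  -- An m-HGR (m ≥ 2), in the equivalent form from the context: a regular
  -- m-Cayley graph of G with all T_{i,i} empty and Aut ≅ G.
  IsHGR : (m : ℕ) → Matrix m → Set
  IsHGR m T = 2 ≤ m × IsCayleyMatrix m T × EmptyDiagonal m T × Regular T × AutIsoG T

  HasHGR : ℕ → Set
  HasHGR m = Σ (Matrix m) (IsHGR m)

{-# OPTIONS --safe #-}
module Submission where

-- Write m = 4 + r with r ≥ 2 even, and extend Σ by r new parts ν₀, …, ν_{r-1}.  The parts
-- Σ₂ — ν₀ — ν₁ — … — ν_{r-1} — Σ₃ are joined along a path by the matchings g ↦ g (parts are
-- numbered from 0, so Σ₂ and Σ₃ are the parts of valency k), and ν_a is joined to ν_b whenever
-- a + b + 1 = r by a connection set of size k - 1.  Every vertex then has valency k + 1.  Since r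
-- is even, the parity of the index properly 2-colours the new parts, and an old vertex meets at
-- most one new vertex, so no triangle passes through a new vertex, whereas every old vertex lies
-- on a triangle of Σ.  Hence an automorphism maps the copy of Σ onto itself, where it is a right
-- translation because Σ is a 4-PGSR.  Peeling the path from both ends, each new vertex is the one
-- neighbour of an already settled vertex that is not yet settled, so the automorphism is that
-- translation everywhere.

open import Defs
open import Data.Nat using (ℕ; suc; _≤_)
open import Data.Nat.Divisibility using (_∣_)
open import Data.Fin using (Fin; zero; suc)
open import Data.Product using (_×_; _,_)
open import Relation.Binary.PropositionalEquality using (_≡_)

open import Algebra.Bundles using (Group)
import Algebra.Properties.Group as GroupProperties
open import Algebra.Structures using (IsGroup)
open import Data.Bool using (Bool; true; false; if_then_else_; T; _∨_)
open import Data.Bool.Properties using (T-≡; T-∨; ∨-comm)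
open import Data.Empty using (⊥; ⊥-elim)
open import Data.Fin using (toℕ; fromℕ<; punchOut; splitAt; _≟_; _↑ˡ_; _↑ʳ_)
open import Data.Fin.Patterns using (0F; 1F; 2F; 3F)
open import Data.Fin.Permutation using (permutation)
open import Data.Fin.Properties
  using (toℕ-fromℕ<; toℕ<n; toℕ-injective; pigeonhole; punchOut-injective; any?; splitAt-↑ˡ; ↑ˡ-injective)
open import Data.List using (map; allFin; tabulate)
open import Data.Nat using (zero; _+_; _*_; _∸_; _<_; _≡ᵇ_; _<ᵇ_; z≤n; s≤s; parity)
open import Data.Nat.Divisibility using (divides)
open import Data.Nat.ListAction using () renaming (sum to listSum)
open import Data.Nat.Properties
  using ( +-*-semiring; +-assoc; +-comm; +-suc; +-identityʳ; +-cancelˡ-≡; +-mono-≤; +-monoʳ-≤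
        ; *-zeroʳ; *-identityʳ; *-monoʳ-≤; ≤-reflexive; ≤-trans; ≤-antisym; <-trans; <-irrefl; <-asym
        ; n<1+n; n≤1+n; n≮n; 1+n≢n; m≤m+n; m≤n+m; m+[n∸m]≡n; ∸-monoˡ-≤; suc-injective; n<1⇒n≡0
        ; <⇒≢; <⇒≱; ≮⇒≥; m≤n⇒m<n∨m≡n; m<1+n⇒m<n∨m≡n; ≡ᵇ⇒≡; ≡⇒≡ᵇ; <ᵇ⇒<; <⇒<ᵇ)
open import Data.Nat.Solver using (module +-*-Solver)
open import Data.Parity using (Parity; 0ℙ; 1ℙ; _⁻¹) renaming (_+_ to _+ℙ_)
open import Data.Parity.Properties using (suc-homo-⁻¹; +-homo-+; *-homo-*; p≢p⁻¹; p+p≡0ℙ)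
import Data.Parity.Properties as ℙ
open import Data.Product using (Σ; ∃; proj₁; proj₂)
import Data.Product.Properties as ×
open import Data.Sum using (_⊎_; inj₁; inj₂)
import Data.Sum as Sum
open import Data.Unit using (tt)
open import Function using (_∘_; id)
open import Function.Bundles using (Equivalence)
open import Level using (0ℓ)
open import Relation.Binary.PropositionalEquality
  using (_≢_; refl; sym; trans; cong; cong₂; cong-app; subst; _≗_; module ≡-Reasoning)
open import Relation.Nullary using (¬_; Dec; yes; no)

open import Algebra.Properties.Semiring.Sum +-*-semiring
  using (sum-syntax; sum-cong-≗; sum-replicate-zero; sum-permute; ∑-distrib-+; *-distribˡ-sum)

χ : Bool → ℕ
χ b = if b then 1 else 0

δ : ℕ → ℕ → ℕ
δ x y = χ (x ≡ᵇ y)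

1≤χ : ∀ {b} → T b → 1 ≤ χ b
1≤χ {true} _ = s≤s z≤n

χ≤1 : ∀ b → χ b ≤ 1
χ≤1 false = z≤n
χ≤1 true  = s≤s z≤n

χ+*χ≤1+ : ∀ p c q → χ p + c * χ q ≤ 1 + c
χ+*χ≤1+ p c q = +-mono-≤ (χ≤1 p) (≤-trans (*-monoʳ-≤ c (χ≤1 q)) (≤-reflexive (*-identityʳ c)))

χ-∨ : ∀ x y → ¬ (T x × T y) → χ (x ∨ y) ≡ χ x + χ y
χ-∨ true  true  not-both = ⊥-elim (not-both (tt , tt))
χ-∨ true  false _        = refl
χ-∨ false _     _        = refl

<ᵇ≡true⇒< : ∀ m n → (m <ᵇ n) ≡ true → m < n
<ᵇ≡true⇒< m n m<ᵇn = <ᵇ⇒< m n (subst T (sym m<ᵇn) tt)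

<ᵇ≡false⇒≥ : ∀ m n → (m <ᵇ n) ≡ false → n ≤ m
<ᵇ≡false⇒≥ m n m≮ᵇn = ≮⇒≥ (λ m<n → subst T m≮ᵇn (<⇒<ᵇ m<n))

χ-<ᵇ≡1 : ∀ {m n} → m < n → χ (m <ᵇ n) ≡ 1
χ-<ᵇ≡1 {m} {n} m<n with m <ᵇ n | <⇒<ᵇ m<n
... | true | _ = refl

χ-<ᵇ≡0 : ∀ {m n} → ¬ m < n → χ (m <ᵇ n) ≡ 0
χ-<ᵇ≡0 {m} {n} m≮n with m <ᵇ n in m<ᵇn
... | true  = ⊥-elim (m≮n (<ᵇ≡true⇒< m n m<ᵇn))
... | false = refl

≡ᵇ-≢ : ∀ {m n} → m ≢ n → (m ≡ᵇ n) ≡ false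
≡ᵇ-≢ {m} {n} m≢n with m ≡ᵇ n in m≡ᵇn
... | true  = ⊥-elim (m≢n (≡ᵇ⇒≡ m n (subst T (sym m≡ᵇn) tt)))
... | false = refl

δ-refl : ∀ m → δ m m ≡ 1
δ-refl zero    = refl
δ-refl (suc m) = δ-refl m

δ-sym : ∀ m n → δ m n ≡ δ n m
δ-sym zero    zero    = refl
δ-sym zero    (suc n) = refl
δ-sym (suc m) zero    = refl
δ-sym (suc m) (suc n) = δ-sym m n

δ-+ˡ : ∀ a x y → δ (a + x) (a + y) ≡ δ x y
δ-+ˡ zero    x y = refl
δ-+ˡ (suc a) x y = δ-+ˡ a x y

listSum-map-tabulate : ∀ {A : Set} n (f : A → ℕ) (g : Fin n → A) →
                       listSum (map f (tabulate g)) ≡ ∑[ i < n ] f (g i)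
listSum-map-tabulate zero    f g = refl
listSum-map-tabulate (suc n) f g = cong (f (g zero) +_) (listSum-map-tabulate n f (g ∘ suc))

listSum-map-allFin : ∀ n (f : Fin n → ℕ) → listSum (map f (allFin n)) ≡ ∑[ i < n ] f i
listSum-map-allFin n f = listSum-map-tabulate n f id

∑-reindex : ∀ {n} (f : Fin n → ℕ) (β β⁻¹ : Fin n → Fin n) →
            β ∘ β⁻¹ ≗ id → β⁻¹ ∘ β ≗ id → ∑[ i < n ] f (β i) ≡ ∑[ i < n ] f i
∑-reindex f β β⁻¹ ββ⁻¹ β⁻¹β = sym (sum-permute f (permutation β β⁻¹ ββ⁻¹ β⁻¹β))

∑-split : ∀ m n (F : Fin (m + n) → ℕ) →
          ∑[ j < m + n ] F j ≡ ∑[ i < m ] F (i ↑ˡ n) + ∑[ b < n ] F (m ↑ʳ b)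
∑-split zero    n F = refl
∑-split (suc m) n F = trans (cong (F zero +_) (∑-split m n (F ∘ suc))) (sym (+-assoc (F zero) _ _))

∑-initial : ∀ {n s} → s ≤ n → ∑[ i < n ] χ (toℕ i <ᵇ s) ≡ s
∑-initial {n}     {zero}  _         = sum-replicate-zero n
∑-initial {suc n} {suc s} (s≤s s≤n) = cong suc (∑-initial s≤n)

∑-δ : ∀ n t → ∑[ b < n ] δ t (toℕ b) ≡ χ (t <ᵇ n)
∑-δ zero    t       = refl
∑-δ (suc n) zero    = cong suc (sum-replicate-zero n)
∑-δ (suc n) (suc t) = ∑-δ n t

∑-δ-last : ∀ n → 1 ≤ n → ∑[ b < n ] δ n (suc (toℕ b)) ≡ 1
∑-δ-last (suc n) _ = trans (∑-δ (suc n) n) (χ-<ᵇ≡1 (n<1+n n))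

∑-δ-predecessor : ∀ n (a : Fin n) → δ 0 (toℕ a) + ∑[ b < n ] δ (suc (toℕ b)) (toℕ a) ≡ 1
∑-δ-predecessor n a with toℕ a | toℕ<n a
... | zero   | _   = cong suc (sum-replicate-zero n)
... | suc a′ | a<n = begin
  ∑[ b < n ] δ (toℕ b) a′  ≡⟨ sum-cong-≗ {n} (λ b → δ-sym (toℕ b) a′) ⟩
  ∑[ b < n ] δ a′ (toℕ b)  ≡⟨ ∑-δ n a′ ⟩
  χ (a′ <ᵇ n)              ≡⟨ χ-<ᵇ≡1 (<-trans (n<1+n a′) a<n) ⟩
  1                        ∎
  where open ≡-Reasoning

∑-δ-successor : ∀ n (a : Fin n) → δ n (suc (toℕ a)) + ∑[ b < n ] δ (suc (toℕ a)) (toℕ b) ≡ 1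
∑-δ-successor n a =
  trans (cong (δ n (suc (toℕ a)) +_) (∑-δ n (suc (toℕ a)))) (last-or-not (m≤n⇒m<n∨m≡n (toℕ<n a)))
  where
  last-or-not : suc (toℕ a) < n ⊎ suc (toℕ a) ≡ n → δ n (suc (toℕ a)) + χ (suc (toℕ a) <ᵇ n) ≡ 1
  last-or-not (inj₁ 1+a<n) rewrite ≡ᵇ-≢ (<⇒≢ 1+a<n ∘ sym) | χ-<ᵇ≡1 1+a<n = refl
  last-or-not (inj₂ 1+a≡n) rewrite 1+a≡n | δ-refl n | χ-<ᵇ≡0 (n≮n n) = refl

∑-δ-complement : ∀ n (a : Fin n) → ∑[ b < n ] δ n (suc (toℕ a + toℕ b)) ≡ 1
∑-δ-complement n a = begin
  ∑[ b < n ] δ n (suc (toℕ a + toℕ b))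
    ≡⟨ sum-cong-≗ {n} (λ b → trans (cong (λ x → δ x (suc (toℕ a + toℕ b))) (sym 1+a+c≡n))
                                   (δ-+ˡ (suc (toℕ a)) c (toℕ b))) ⟩
  ∑[ b < n ] δ c (toℕ b)
    ≡⟨ ∑-δ n c ⟩
  χ (c <ᵇ n)
    ≡⟨ χ-<ᵇ≡1 (≤-trans (s≤s (m≤n+m c (toℕ a))) (≤-reflexive 1+a+c≡n)) ⟩
  1 ∎
  where
  open ≡-Reasoning
  c : ℕ
  c = n ∸ suc (toℕ a)
  1+a+c≡n : suc (toℕ a + c) ≡ n
  1+a+c≡n = m+[n∸m]≡n (toℕ<n a)

injective⇒surjective : ∀ {n} (f : Fin n → Fin n) → (∀ {x y} → f x ≡ f y → x ≡ y) →
                       ∀ y → ∃ λ x → f x ≡ y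
injective⇒surjective {suc n} f f-inj y with any? (λ x → f x ≟ y)
... | yes found = found
... | no missed =
  let i , j , i<j , eq = pigeonhole (n<1+n n) (λ x → punchOut (y≢f x))
  in ⊥-elim (<-irrefl (cong toℕ (f-inj (punchOut-injective (y≢f i) (y≢f j) eq))) i<j)
  where
  y≢f : ∀ x → y ≢ f x
  y≢f x y≡fx = missed (x , sym y≡fx)

-- b is among the first t or the last t of 0, …, r - 1 (stated without truncated subtraction).
Outer : ℕ → ℕ → ℕ → Set
Outer r t b = b < t ⊎ r ≤ t + b

Outer-suc : ∀ {r t b} → Outer r (suc t) b → Outer r t b ⊎ (b ≡ t ⊎ r ≡ suc (t + b))
Outer-suc (inj₁ b<1+t) with m<1+n⇒m<n∨m≡n b<1+t
... | inj₁ b<t = inj₁ (inj₁ b<t)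
... | inj₂ b≡t = inj₂ (inj₁ b≡t)
Outer-suc (inj₂ r≤1+t+b) with m≤n⇒m<n∨m≡n r≤1+t+b
... | inj₁ (s≤s r≤t+b) = inj₁ (inj₂ r≤t+b)
... | inj₂ r≡1+t+b     = inj₂ (inj₂ r≡1+t+b)

parity-suc≢ : ∀ n → parity (suc n) ≢ parity n
parity-suc≢ n eq = p≢p⁻¹ (parity n) (trans (sym (suc-homo-⁻¹ n)) (cong _⁻¹ eq))

parity-odd-sum : ∀ x y → parity (suc (x + y)) ≡ 0ℙ → parity x ≢ parity y
parity-odd-sum x y even px≡py = parity-suc≢ (x + y) (trans even (sym x+y-even))
  where
  x+y-even : parity (x + y) ≡ 0ℙ
  x+y-even = trans (+-homo-+ x y) (trans (cong (_+ℙ parity y) px≡py) (p+p≡0ℙ (parity y)))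

¬three-distinct-parities : ∀ (p q s : Parity) → p ≢ q → q ≢ s → s ≢ p → ⊥
¬three-distinct-parities 0ℙ 0ℙ _  p≢q _   _   = p≢q refl
¬three-distinct-parities 1ℙ 1ℙ _  p≢q _   _   = p≢q refl
¬three-distinct-parities 0ℙ 1ℙ 0ℙ _   _   s≢p = s≢p refl
¬three-distinct-parities 0ℙ 1ℙ 1ℙ _   q≢s _   = q≢s refl
¬three-distinct-parities 1ℙ 0ℙ 0ℙ _   q≢s _   = q≢s refl
¬three-distinct-parities 1ℙ 0ℙ 1ℙ _   _   s≢p = s≢p refl

even⇒parity≡0ℙ : ∀ {m} → 2 ∣ m → parity m ≡ 0ℙ
even⇒parity≡0ℙ (divides q refl) = trans (*-homo-* q 2) (ℙ.*-comm (parity q) 0ℙ)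

module CayleyGraph (G : FinGroup) where
  open FinGroup G renaming (order to n)
  open IsGroup isGroup using (assoc; identityˡ; inverseʳ)
  open ≡-Reasoning

  group : Group 0ℓ 0ℓ
  group = record { _≈_ = _≡_ ; _∙_ = _·_ ; ε = e ; _⁻¹ = inv ; isGroup = isGroup }

  open GroupProperties group
    using (⁻¹-involutive; ⁻¹-anti-homo-∙; ⁻¹-injective; ε⁻¹≈ε; //-rightDividesˡ; //-rightDividesʳ)

  inv≡e⇒≡e : ∀ {x} → inv x ≡ e → x ≡ e
  inv≡e⇒≡e inv-x≡e = ⁻¹-injective (trans inv-x≡e (sym ε⁻¹≈ε))

  count : Subset G → ℕ
  count S = ∑[ g < n ] χ (S g)

  count-translate : ∀ S a → count (λ g → S (g · a)) ≡ count S
  count-translate S a = ∑-reindex (χ ∘ S) (_· a) (_· inv a) (//-rightDividesˡ a) (//-rightDividesʳ a)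

  count-inverse : ∀ S → count (S ∘ inv) ≡ count S
  count-inverse S = ∑-reindex (χ ∘ S) inv inv ⁻¹-involutive ⁻¹-involutive

  valency≡∑count : ∀ {m} (X : Matrix G m) g i → valency G X (g , i) ≡ ∑[ j < m ] count (X i j)
  valency≡∑count {m} X g i = begin
    valency G X (g , i)
      ≡⟨ listSum-map-allFin m _ ⟩
    ∑[ j < m ] listSum (map (λ h → χ (X i j (h · inv g))) (allFin n))
      ≡⟨ sum-cong-≗ {m} (λ j → trans (listSum-map-allFin n _) (count-translate (X i j) (inv g))) ⟩
    ∑[ j < m ] count (X i j) ∎

  c₀ : Fin n
  c₀ = fromℕ< (≤-trans (s≤s z≤n) (toℕ<n e))

  toℕ-c₀ : toℕ c₀ ≡ 0
  toℕ-c₀ = toℕ-fromℕ< _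

  -- Seg s = {0, …, s - 1} · c₀⁻¹: a right translate of an initial segment, chosen to contain e once s ≥ 1.
  Seg : ℕ → Subset G
  Seg s g = toℕ (g · c₀) <ᵇ s

  count-Seg : ∀ {s} → s ≤ n → count (Seg s) ≡ s
  count-Seg {s} s≤n = trans (count-translate (λ g → toℕ g <ᵇ s) c₀) (∑-initial s≤n)

  Seg-e : ∀ {s} → 1 ≤ s → Seg s e ≡ true
  Seg-e {suc s} _ rewrite identityˡ c₀ | toℕ-c₀ = refl

  Seg-χ : ∀ {p x} → Seg (χ p) x ≡ true → T p × x ≡ e
  Seg-χ {false} ()
  Seg-χ {true} {x} x∈Seg = tt , (begin
    x                  ≡⟨ //-rightDividesʳ c₀ x ⟨
    (x · c₀) · inv c₀  ≡⟨ cong (_· inv c₀) (toℕ-injective xc₀≡c₀) ⟩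
    c₀ · inv c₀        ≡⟨ inverseʳ c₀ ⟩
    e                  ∎)
    where
    xc₀≡c₀ : toℕ (x · c₀) ≡ toℕ c₀
    xc₀≡c₀ = trans (n<1⇒n≡0 (<ᵇ⇒< _ 1 (Equivalence.from T-≡ x∈Seg))) (sym toℕ-c₀)

  Seg-χ+*χ : ∀ {p q} c {x} → Seg (χ p + c * χ q) x ≡ true → T q ⊎ (T p × x ≡ e)
  Seg-χ+*χ {q = true}  c _ = inj₁ tt
  Seg-χ+*χ {p} {false} c {x} x∈Seg rewrite *-zeroʳ c | +-identityʳ (χ p) = inj₂ (Seg-χ x∈Seg)

  ρ : ∀ {m} → Fin n → Vertex G m → Vertex G m
  ρ x (g , i) = (g · inv x , i)

  ρ-adj : ∀ {m} (X : Matrix G m) x u v → adj G X (ρ x u) (ρ x v) ≡ adj G X u v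
  ρ-adj X x (g , i) (h , j) = cong (X i j) (begin
    (h · inv x) · inv (g · inv x)        ≡⟨ cong ((h · inv x) ·_) (⁻¹-anti-homo-∙ g (inv x)) ⟩
    (h · inv x) · (inv (inv x) · inv g)  ≡⟨ cong (λ y → (h · inv x) · (y · inv g)) (⁻¹-involutive x) ⟩
    (h · inv x) · (x · inv g)            ≡⟨ assoc (h · inv x) x (inv g) ⟨
    ((h · inv x) · x) · inv g            ≡⟨ cong (_· inv g) (//-rightDividesˡ x h) ⟩
    h · inv g                            ∎)

  ρ-isAut : ∀ {m} (X : Matrix G m) x → IsAut G X (ρ x)
  ρ-isAut X x = ρ (inv x) , ρ⁻¹∘ρ , ρ∘ρ⁻¹ , ρ-adj X x
    where
    ρ⁻¹∘ρ : ∀ v → ρ (inv x) (ρ x v) ≡ v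
    ρ⁻¹∘ρ (g , i) = cong (_, i) (trans (cong ((g · inv x) ·_) (⁻¹-involutive x)) (//-rightDividesˡ x g))
    ρ∘ρ⁻¹ : ∀ v → ρ x (ρ (inv x) v) ≡ v
    ρ∘ρ⁻¹ (g , i) =
      cong (_, i) (trans (cong (λ y → (g · y) · inv x) (⁻¹-involutive x)) (//-rightDividesʳ x g))

  ρ-∙ : ∀ {m} x y (v : Vertex G m) → ρ (x · y) v ≡ ρ x (ρ y v)
  ρ-∙ x y (g , i) = cong (_, i) (trans (cong (g ·_) (⁻¹-anti-homo-∙ x y)) (sym (assoc g (inv y) (inv x))))

  ρ-injective : ∀ {m} → Fin m → ∀ {x y} → ρ {m} x ≗ ρ y → x ≡ y
  ρ-injective i {x} {y} ρx≗ρy = ⁻¹-injective (begin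
    inv x      ≡⟨ identityˡ (inv x) ⟨
    e · inv x  ≡⟨ cong proj₁ (ρx≗ρy (e , i)) ⟩
    e · inv y  ≡⟨ identityˡ (inv y) ⟩
    inv y      ∎)

  _≟ᵥ_ : ∀ {m} (u v : Vertex G m) → Dec (u ≡ v)
  _≟ᵥ_ = ×.≡-dec _≟_ _≟_

  IsAut-injective : ∀ {m} {X : Matrix G m} {f} → IsAut G X f → ∀ {u v} → f u ≡ f v → u ≡ v
  IsAut-injective (f⁻¹ , f⁻¹∘f , _) {u} {v} fu≡fv =
    trans (sym (f⁻¹∘f u)) (trans (cong f⁻¹ fu≡fv) (f⁻¹∘f v))

  IsAut-inverse : ∀ {m} {X : Matrix G m} {f} (f-aut : IsAut G X f) → IsAut G X (proj₁ f-aut)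
  IsAut-inverse {X = X} {f} (f⁻¹ , f⁻¹∘f , f∘f⁻¹ , f-adj) =
    f , f∘f⁻¹ , f⁻¹∘f ,
    λ u v → trans (sym (f-adj (f⁻¹ u) (f⁻¹ v))) (cong₂ (adj G X) (f∘f⁻¹ u) (f∘f⁻¹ v))

  -- f′⁻¹ ∘ f permutes the neighbours of u, so it cannot move v while fixing all the others.
  agree-at-neighbour : ∀ {m} {X : Matrix G m} {f f′} → IsAut G X f → IsAut G X f′ →
    ∀ {u v} → f u ≡ f′ u → adj G X u v ≡ true →
    (∀ w → adj G X u w ≡ true → w ≢ v → f w ≡ f′ w) → f v ≡ f′ v
  agree-at-neighbour {X = X} {f} {f′} f-aut (f′⁻¹ , _ , f′∘f′⁻¹ , f′-adj) {u} {v} fu≡f′u u~v others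
    with f′⁻¹ (f v) ≟ᵥ v
  ... | yes w≡v = trans (sym (f′∘f′⁻¹ (f v))) (cong f′ w≡v)
  ... | no  w≢v = ⊥-elim (w≢v (IsAut-injective {X = X} f-aut (trans (others w u~w w≢v) (f′∘f′⁻¹ (f v)))))
    where
    w : Vertex G _
    w = f′⁻¹ (f v)
    u~w : adj G X u w ≡ true
    u~w = begin
      adj G X u w            ≡⟨ f′-adj u w ⟨
      adj G X (f′ u) (f′ w)  ≡⟨ cong₂ (adj G X) (sym fu≡f′u) (f′∘f′⁻¹ (f v)) ⟩
      adj G X (f u) (f v)    ≡⟨ proj₂ (proj₂ (proj₂ f-aut)) u v ⟩
      adj G X u v            ≡⟨ u~v ⟩
      true                   ∎

  record IsEmbedding {m m′} (X : Matrix G m) (X′ : Matrix G m′) (ι : Vertex G m → Vertex G m′) : Set where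
    field
      injective : ∀ {u v} → ι u ≡ ι v → u ≡ v
      adj-ι     : ∀ u v → adj G X′ (ι u) (ι v) ≡ adj G X u v

  IsAut⇒IsEmbedding : ∀ {m} {X : Matrix G m} {f} → IsAut G X f → IsEmbedding X X f
  IsAut⇒IsEmbedding {X = X} f-aut =
    record { injective = IsAut-injective {X = X} f-aut ; adj-ι = proj₂ (proj₂ (proj₂ f-aut)) }

  IsEmbedding-triangle : ∀ {m m′} {X : Matrix G m} {X′ : Matrix G m′} {ι} → IsEmbedding X X′ ι →
    ∀ {v} → HasTriangleThrough G X v → HasTriangleThrough G X′ (ι v)
  IsEmbedding-triangle {ι = ι} emb {v} (u , w , v≢u , v≢w , u≢w , v~u , u~w , w~v) =
    ι u , ι w , v≢u ∘ injective , v≢w ∘ injective , u≢w ∘ injective ,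
    trans (adj-ι v u) v~u , trans (adj-ι u w) u~w , trans (adj-ι w v) w~v
    where open IsEmbedding emb

  IsAut-restrict : ∀ {m m′} {X : Matrix G m} {X′ : Matrix G m′} {ι} → IsEmbedding X X′ ι →
    ∀ {f f₀ f₀′} (f-aut : IsAut G X′ f) →
    (∀ v → f (ι v) ≡ ι (f₀ v)) → (∀ v → proj₁ f-aut (ι v) ≡ ι (f₀′ v)) → IsAut G X f₀
  IsAut-restrict {X = X} {X′} {ι} emb {f} {f₀} {f₀′} (f⁻¹ , f⁻¹∘f , f∘f⁻¹ , f-adj) f∘ι f⁻¹∘ι =
    f₀′ ,
    (λ v → injective (cancel f⁻¹ f₀′ f f₀ f⁻¹∘ι f∘ι f⁻¹∘f v)) ,
    (λ v → injective (cancel f f₀ f⁻¹ f₀′ f∘ι f⁻¹∘ι f∘f⁻¹ v)) ,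
    f₀-adj
    where
    open IsEmbedding emb
    cancel : ∀ g g₀ h h₀ → (∀ v → g (ι v) ≡ ι (g₀ v)) → (∀ v → h (ι v) ≡ ι (h₀ v)) →
             (∀ y → g (h y) ≡ y) → ∀ v → ι (g₀ (h₀ v)) ≡ ι v
    cancel g g₀ h h₀ g∘ι h∘ι g∘h v = trans (sym (g∘ι (h₀ v))) (trans (cong g (sym (h∘ι v))) (g∘h (ι v)))
    f₀-adj : ∀ u v → adj G X (f₀ u) (f₀ v) ≡ adj G X u v
    f₀-adj u v = begin
      adj G X (f₀ u) (f₀ v)           ≡⟨ adj-ι (f₀ u) (f₀ v) ⟨
      adj G X′ (ι (f₀ u)) (ι (f₀ v))  ≡⟨ cong₂ (adj G X′) (f∘ι u) (f∘ι v) ⟨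
      adj G X′ (f (ι u)) (f (ι v))    ≡⟨ f-adj (ι u) (ι v) ⟩
      adj G X′ (ι u) (ι v)            ≡⟨ adj-ι u v ⟩
      adj G X u v                     ∎

  -- ψ x is the element that φ sends to ρ x; it is injective, hence onto as G is finite.
  translations-exhaust : ∀ {m} (X : Matrix G (suc m)) → AutIsoG G X →
                         ∀ f → IsAut G X f → ∃ λ x → f ≗ ρ x
  translations-exhaust X (φ , _ , _ , _ , φ-onto) f f-aut =
    let g , f≗φg = φ-onto f f-aut
        x , ψx≡g = injective⇒surjective ψ ψ-injective g
    in x , λ v → begin
      f v        ≡⟨ f≗φg v ⟩
      φ g v      ≡⟨ cong (λ h → φ h v) ψx≡g ⟨
      φ (ψ x) v  ≡⟨ ψ-spec x v ⟨
      ρ x v      ∎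
    where
    ψ : Fin n → Fin n
    ψ x = proj₁ (φ-onto (ρ x) (ρ-isAut X x))
    ψ-spec : ∀ x → ρ x ≗ φ (ψ x)
    ψ-spec x = proj₂ (φ-onto (ρ x) (ρ-isAut X x))
    ψ-injective : ∀ {x y} → ψ x ≡ ψ y → x ≡ y
    ψ-injective {x} {y} ψx≡ψy =
      ρ-injective zero (λ v → trans (ψ-spec x v) (trans (cong (λ h → φ h v) ψx≡ψy) (sym (ψ-spec y v))))

  translations-AutIsoG : ∀ {m} (X : Matrix G (suc m)) →
                         (∀ f → IsAut G X f → ∃ λ x → f ≗ ρ x) → AutIsoG G X
  translations-AutIsoG X exhaust = ρ , ρ-isAut X , ρ-∙ , (λ x y → ρ-injective zero) , exhaust

-- Parts of Cay(G, T′): l ↑ˡ r is the old part Σ_l, and 4 ↑ʳ b the new part ν_b.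
module Extension (G : FinGroup) (T₄ : Matrix G 4) (k r : ℕ)
                 (1≤k : 1 ≤ k) (k≤n : k ≤ FinGroup.order G) (2≤r : 2 ≤ r) (r-even : parity r ≡ 0ℙ) where
  open FinGroup G renaming (order to n)
  open CayleyGraph G
  open IsGroup isGroup using (inverseʳ)
  open GroupProperties group using (⁻¹-involutive; ε⁻¹≈ε; x∙y⁻¹≈ε⇒x≈y)
  open ≡-Reasoning

  attach : Fin 4 → Fin r → Bool
  attach 2F b = 0 ≡ᵇ toℕ b
  attach 3F b = r ≡ᵇ suc (toℕ b)
  attach _  _ = false

  path : Fin r → Fin r → Bool
  path a b = (suc (toℕ a) ≡ᵇ toℕ b) ∨ (suc (toℕ b) ≡ᵇ toℕ a)

  chord : Fin r → Fin r → Bool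
  chord a b = r ≡ᵇ suc (toℕ a + toℕ b)

  weight : Fin r → Fin r → ℕ
  weight a b = χ (path a b) + (k ∸ 1) * χ (chord a b)

  connection : Fin 4 ⊎ Fin r → Fin 4 ⊎ Fin r → Subset G
  connection (inj₁ l) (inj₁ l′) = T₄ l l′
  connection (inj₁ l) (inj₂ b)  = Seg (χ (attach l b))
  connection (inj₂ a) (inj₁ l)  = Seg (χ (attach l a)) ∘ inv
  connection (inj₂ a) (inj₂ b)  = if toℕ a <ᵇ toℕ b then Seg (weight a b) else Seg (weight a b) ∘ inv

  T′ : Matrix G (4 + r)
  T′ i j = connection (splitAt 4 i) (splitAt 4 j)

  data Part : Fin (4 + r) → Set where
    old : ∀ l → Part (l ↑ˡ r)
    new : ∀ b → Part (4 ↑ʳ b)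

  part : ∀ i → Part i
  part 0F = old 0F
  part 1F = old 1F
  part 2F = old 2F
  part 3F = old 3F
  part (suc (suc (suc (suc b)))) = new b

  ι : Vertex G 4 → Vertex G (4 + r)
  ι (g , l) = (g , l ↑ˡ r)

  T′-old-old : ∀ l l′ → T′ (l ↑ˡ r) (l′ ↑ˡ r) ≡ T₄ l l′
  T′-old-old l l′ rewrite splitAt-↑ˡ 4 l r | splitAt-↑ˡ 4 l′ r = refl

  T′-old-new : ∀ l b → T′ (l ↑ˡ r) (4 ↑ʳ b) ≡ Seg (χ (attach l b))
  T′-old-new l b rewrite splitAt-↑ˡ 4 l r = refl

  T′-new-old : ∀ a l → T′ (4 ↑ʳ a) (l ↑ˡ r) ≡ Seg (χ (attach l a)) ∘ inv
  T′-new-old a l rewrite splitAt-↑ˡ 4 l r = refl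

  r≢1 : r ≢ 1
  r≢1 r≡1 = <-irrefl refl (≤-trans 2≤r (≤-reflexive r≡1))

  attach-first : ∀ {b} → toℕ b ≡ 0 → T (attach 2F b)
  attach-first b≡0 = ≡⇒≡ᵇ 0 _ (sym b≡0)

  attach-last : ∀ {b} → r ≡ suc (toℕ b) → T (attach 3F b)
  attach-last = ≡⇒≡ᵇ r _

  attach-functional : ∀ l {b b′} → T (attach l b) → T (attach l b′) → b ≡ b′
  attach-functional 2F att att′ = toℕ-injective (trans (sym (≡ᵇ⇒≡ 0 _ att)) (≡ᵇ⇒≡ 0 _ att′))
  attach-functional 3F att att′ = toℕ-injective (suc-injective (trans (sym (≡ᵇ⇒≡ r _ att)) (≡ᵇ⇒≡ r _ att′)))

  attach-injective : ∀ l l′ {b} → T (attach l b) → T (attach l′ b) → l ≡ l′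
  attach-injective 2F 2F _   _    = refl
  attach-injective 3F 3F _   _    = refl
  attach-injective 2F 3F att att′ = ⊥-elim (r≢1 (trans (≡ᵇ⇒≡ r _ att′) (cong suc (sym (≡ᵇ⇒≡ 0 _ att)))))
  attach-injective 3F 2F att att′ = ⊥-elim (r≢1 (trans (≡ᵇ⇒≡ r _ att) (cong suc (sym (≡ᵇ⇒≡ 0 _ att′)))))

  path-view : ∀ a b → T (path a b) → suc (toℕ a) ≡ toℕ b ⊎ suc (toℕ b) ≡ toℕ a
  path-view a b p = Sum.map (≡ᵇ⇒≡ _ _) (≡ᵇ⇒≡ _ _) (Equivalence.to (T-∨ {suc (toℕ a) ≡ᵇ toℕ b}) p)

  path-up : ∀ a b → suc (toℕ a) ≡ toℕ b → T (path a b)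
  path-up a b 1+a≡b = Equivalence.from T-∨ (inj₁ (≡⇒≡ᵇ _ _ 1+a≡b))

  path-down : ∀ a b → suc (toℕ b) ≡ toℕ a → T (path a b)
  path-down a b 1+b≡a = Equivalence.from T-∨ (inj₂ (≡⇒≡ᵇ _ _ 1+b≡a))

  path-sym : ∀ a b → path a b ≡ path b a
  path-sym a b = ∨-comm (suc (toℕ a) ≡ᵇ toℕ b) _

  chord-sym : ∀ a b → chord a b ≡ chord b a
  chord-sym a b = cong (λ x → r ≡ᵇ suc x) (+-comm (toℕ a) (toℕ b))

  path-parity : ∀ a b → T (path a b) → parity (toℕ a) ≢ parity (toℕ b)
  path-parity a b p with path-view a b p
  ... | inj₁ 1+a≡b = λ pa≡pb → parity-suc≢ (toℕ a) (trans (cong parity 1+a≡b) (sym pa≡pb))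
  ... | inj₂ 1+b≡a = λ pa≡pb → parity-suc≢ (toℕ b) (trans (cong parity 1+b≡a) pa≡pb)

  chord-parity : ∀ a b → T (chord a b) → parity (toℕ a) ≢ parity (toℕ b)
  chord-parity a b c = parity-odd-sum (toℕ a) (toℕ b) (trans (cong parity (sym (≡ᵇ⇒≡ r _ c))) r-even)

  weight-sym : ∀ a b → weight a b ≡ weight b a
  weight-sym a b = cong₂ (λ p c → χ p + (k ∸ 1) * χ c) (path-sym a b) (chord-sym a b)

  weight-diag : ∀ a → weight a a ≡ 0
  weight-diag a
    rewrite ≡ᵇ-≢ (1+n≢n {toℕ a})
          | ≡ᵇ-≢ {r} {suc (toℕ a + toℕ a)} (λ r≡ → chord-parity a a (≡⇒≡ᵇ r _ r≡) refl)
          = *-zeroʳ (k ∸ 1)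

  weight≤n : ∀ a b → weight a b ≤ n
  weight≤n a b =
    ≤-trans (χ+*χ≤1+ (path a b) (k ∸ 1) (chord a b)) (≤-trans (≤-reflexive (m+[n∸m]≡n 1≤k)) k≤n)

  χ-attach≤n : ∀ l b → χ (attach l b) ≤ n
  χ-attach≤n l b = ≤-trans (χ≤1 (attach l b)) (≤-trans 1≤k k≤n)

  connection-new-diag : ∀ a g → connection (inj₂ a) (inj₂ a) g ≡ false
  connection-new-diag a g rewrite weight-diag a with toℕ a <ᵇ toℕ a
  ... | true  = refl
  ... | false = refl

  connection-sym : (∀ l l′ g → T₄ l′ l g ≡ T₄ l l′ (inv g)) →
                   ∀ x y g → connection y x g ≡ connection x y (inv g)
  connection-sym T₄-sym (inj₁ l) (inj₁ l′) g = T₄-sym l l′ g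
  connection-sym T₄-sym (inj₁ l) (inj₂ b)  g = refl
  connection-sym T₄-sym (inj₂ a) (inj₁ l)  g = cong (Seg (χ (attach l a))) (sym (⁻¹-involutive g))
  connection-sym T₄-sym (inj₂ a) (inj₂ b)  g rewrite weight-sym b a
    with toℕ a <ᵇ toℕ b in a<ᵇb | toℕ b <ᵇ toℕ a in b<ᵇa
  ... | true  | true  =
    ⊥-elim (<-asym (<ᵇ≡true⇒< (toℕ a) (toℕ b) a<ᵇb) (<ᵇ≡true⇒< (toℕ b) (toℕ a) b<ᵇa))
  ... | true  | false = refl
  ... | false | true  = cong (Seg (weight a b)) (sym (⁻¹-involutive g))
  ... | false | false
    with toℕ-injective (≤-antisym (<ᵇ≡false⇒≥ (toℕ b) (toℕ a) b<ᵇa) (<ᵇ≡false⇒≥ (toℕ a) (toℕ b) a<ᵇb))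
  ...   | refl rewrite weight-diag a = refl

  T′-emptyDiagonal : EmptyDiagonal G 4 T₄ → EmptyDiagonal G (4 + r) T′
  T′-emptyDiagonal empty i g with splitAt 4 i
  ... | inj₁ l = empty l g
  ... | inj₂ a = connection-new-diag a g

  T′-isCayley : IsCayleyMatrix G 4 T₄ → EmptyDiagonal G 4 T₄ → IsCayleyMatrix G (4 + r) T′
  T′-isCayley (_ , T₄-sym) empty =
    (λ i → T′-emptyDiagonal empty i e) , λ i j g → connection-sym T₄-sym (splitAt 4 i) (splitAt 4 j) g

  count-old-old : ∀ l l′ → count (T′ (l ↑ˡ r) (l′ ↑ˡ r)) ≡ count (T₄ l l′)
  count-old-old l l′ = cong count (T′-old-old l l′)

  count-old-new : ∀ l b → count (T′ (l ↑ˡ r) (4 ↑ʳ b)) ≡ χ (attach l b)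
  count-old-new l b = trans (cong count (T′-old-new l b)) (count-Seg (χ-attach≤n l b))

  count-new-old : ∀ a l → count (T′ (4 ↑ʳ a) (l ↑ˡ r)) ≡ χ (attach l a)
  count-new-old a l = trans (cong count (T′-new-old a l)) (trans (count-inverse _) (count-Seg (χ-attach≤n l a)))

  count-new-new : ∀ a b → count (T′ (4 ↑ʳ a) (4 ↑ʳ b)) ≡ weight a b
  count-new-new a b with toℕ a <ᵇ toℕ b
  ... | true  = count-Seg (weight≤n a b)
  ... | false = trans (count-inverse _) (count-Seg (weight≤n a b))

  valency-old : ∀ g l → valency G T′ (g , l ↑ˡ r) ≡ valency G T₄ (g , l) + ∑[ b < r ] χ (attach l b)
  valency-old g l = begin
    valency G T′ (g , l ↑ˡ r)
      ≡⟨ valency≡∑count T′ g (l ↑ˡ r) ⟩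
    ∑[ j < 4 + r ] count (T′ (l ↑ˡ r) j)
      ≡⟨ ∑-split 4 r (count ∘ T′ (l ↑ˡ r)) ⟩
    ∑[ l′ < 4 ] count (T′ (l ↑ˡ r) (l′ ↑ˡ r)) + ∑[ b < r ] count (T′ (l ↑ˡ r) (4 ↑ʳ b))
      ≡⟨ cong₂ _+_ (trans (sum-cong-≗ {4} (count-old-old l)) (sym (valency≡∑count T₄ g l)))
                   (sum-cong-≗ {r} (count-old-new l)) ⟩
    valency G T₄ (g , l) + ∑[ b < r ] χ (attach l b) ∎

  path-not-both : ∀ (a b : Fin r) → ¬ (T (suc (toℕ a) ≡ᵇ toℕ b) × T (suc (toℕ b) ≡ᵇ toℕ a))
  path-not-both a b (a→b , b→a) = <-irrefl (sym 2+a≡a) (n≤1+n (suc (toℕ a)))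
    where
    2+a≡a : suc (suc (toℕ a)) ≡ toℕ a
    2+a≡a = trans (cong suc (≡ᵇ⇒≡ _ _ a→b)) (≡ᵇ⇒≡ _ _ b→a)

  χ-path : ∀ a b → χ (path a b) ≡ δ (suc (toℕ a)) (toℕ b) + δ (suc (toℕ b)) (toℕ a)
  χ-path a b = χ-∨ (suc (toℕ a) ≡ᵇ toℕ b) (suc (toℕ b) ≡ᵇ toℕ a) (path-not-both a b)

  successors predecessors : Fin r → ℕ
  successors   a = ∑[ b < r ] δ (suc (toℕ a)) (toℕ b)
  predecessors a = ∑[ b < r ] δ (suc (toℕ b)) (toℕ a)

  ∑-weight : ∀ a → ∑[ b < r ] weight a b ≡ (successors a + predecessors a) + (k ∸ 1)
  ∑-weight a = begin
    ∑[ b < r ] weight a b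
      ≡⟨ ∑-distrib-+ {r} (λ b → χ (path a b)) (λ b → (k ∸ 1) * χ (chord a b)) ⟩
    ∑[ b < r ] χ (path a b) + ∑[ b < r ] ((k ∸ 1) * χ (chord a b))
      ≡⟨ cong₂ _+_ (trans (sum-cong-≗ {r} (χ-path a))
                          (∑-distrib-+ {r} (λ b → δ (suc (toℕ a)) (toℕ b)) (λ b → δ (suc (toℕ b)) (toℕ a))))
                   (sym (*-distribˡ-sum {r} (k ∸ 1) (λ b → χ (chord a b)))) ⟩
    (successors a + predecessors a) + (k ∸ 1) * ∑[ b < r ] χ (chord a b)
      ≡⟨ cong (λ x → (successors a + predecessors a) + (k ∸ 1) * x) (∑-δ-complement r a) ⟩
    (successors a + predecessors a) + (k ∸ 1) * 1
      ≡⟨ cong ((successors a + predecessors a) +_) (*-identityʳ (k ∸ 1)) ⟩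
    (successors a + predecessors a) + (k ∸ 1) ∎

  valency-new : ∀ g a → valency G T′ (g , 4 ↑ʳ a) ≡ suc k
  valency-new g a = begin
    valency G T′ (g , 4 ↑ʳ a)
      ≡⟨ valency≡∑count T′ g (4 ↑ʳ a) ⟩
    ∑[ j < 4 + r ] count (T′ (4 ↑ʳ a) j)
      ≡⟨ ∑-split 4 r (count ∘ T′ (4 ↑ʳ a)) ⟩
    ∑[ l < 4 ] count (T′ (4 ↑ʳ a) (l ↑ˡ r)) + ∑[ b < r ] count (T′ (4 ↑ʳ a) (4 ↑ʳ b))
      ≡⟨ cong₂ _+_ (sum-cong-≗ {4} (count-new-old a))
                   (trans (sum-cong-≗ {r} (count-new-new a)) (∑-weight a)) ⟩
    ∑[ l < 4 ] χ (attach l a) + ((successors a + predecessors a) + (k ∸ 1))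
      ≡⟨ solve 5 (λ A B X Y K → (con 0 :+ (con 0 :+ (A :+ (B :+ con 0)))) :+ ((X :+ Y) :+ K)
                                 := (A :+ Y) :+ ((B :+ X) :+ K))
                 refl (δ 0 (toℕ a)) (δ r (suc (toℕ a))) (successors a) (predecessors a) (k ∸ 1) ⟩
    (δ 0 (toℕ a) + predecessors a) + ((δ r (suc (toℕ a)) + successors a) + (k ∸ 1))
      ≡⟨ cong₂ (λ x y → x + (y + (k ∸ 1))) (∑-δ-predecessor r a) (∑-δ-successor r a) ⟩
    suc (suc (k ∸ 1))
      ≡⟨ cong suc (m+[n∸m]≡n 1≤k) ⟩
    suc k ∎
    where open +-*-Solver

  T′-regular : (∀ g → valency G T₄ (g , 0F) ≡ suc k × valency G T₄ (g , 1F) ≡ suc k) →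
               (∀ g → valency G T₄ (g , 2F) ≡ k × valency G T₄ (g , 3F) ≡ k) →
               Regular G T′
  T′-regular val₀₁ val₂₃ (g , i) (h , j) = trans (valency≡1+k g i) (sym (valency≡1+k h j))
    where
    1≤r : 1 ≤ r
    1≤r = ≤-trans (s≤s z≤n) 2≤r
    valency≡1+k : ∀ g i → valency G T′ (g , i) ≡ suc k
    valency≡1+k g i with part i
    ... | new a  = valency-new g a
    ... | old 0F = trans (valency-old g 0F)
                         (trans (cong₂ _+_ (proj₁ (val₀₁ g)) (sum-replicate-zero r)) (+-identityʳ _))
    ... | old 1F = trans (valency-old g 1F)
                         (trans (cong₂ _+_ (proj₂ (val₀₁ g)) (sum-replicate-zero r)) (+-identityʳ _))
    ... | old 2F = trans (valency-old g 2F)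
                         (trans (cong₂ _+_ (proj₁ (val₂₃ g)) (trans (∑-δ r 0) (χ-<ᵇ≡1 1≤r))) (+-comm k 1))
    ... | old 3F = trans (valency-old g 3F)
                         (trans (cong₂ _+_ (proj₂ (val₂₃ g)) (∑-δ-last r 1≤r)) (+-comm k 1))

  old-new-adj : ∀ g h l b → adj G T′ (g , l ↑ˡ r) (h , 4 ↑ʳ b) ≡ true → h ≡ g × T (attach l b)
  old-new-adj g h l b g~h with Seg-χ {attach l b} (trans (sym (cong-app (T′-old-new l b) (h · inv g))) g~h)
  ... | att , h/g≡e = x∙y⁻¹≈ε⇒x≈y h g h/g≡e , att

  new-old-adj : ∀ g h a l → adj G T′ (g , 4 ↑ʳ a) (h , l ↑ˡ r) ≡ true → h ≡ g × T (attach l a)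
  new-old-adj g h a l g~h with Seg-χ {attach l a} (trans (sym (cong-app (T′-new-old a l) (h · inv g))) g~h)
  ... | att , g/h≡e = x∙y⁻¹≈ε⇒x≈y h g (inv≡e⇒≡e g/h≡e) , att

  new-new-adj : ∀ g h a b → adj G T′ (g , 4 ↑ʳ a) (h , 4 ↑ʳ b) ≡ true →
                T (chord a b) ⊎ (h ≡ g × T (path a b))
  new-new-adj g h a b g~h with toℕ a <ᵇ toℕ b
  ... | true  = Sum.map₂ (λ (p , h/g≡e) → x∙y⁻¹≈ε⇒x≈y h g h/g≡e , p)
                         (Seg-χ+*χ {path a b} {chord a b} (k ∸ 1) g~h)
  ... | false = Sum.map₂ (λ (p , g/h≡e) → x∙y⁻¹≈ε⇒x≈y h g (inv≡e⇒≡e g/h≡e) , p)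
                         (Seg-χ+*χ {path a b} {chord a b} (k ∸ 1) g~h)

  new-new-adj-parity : ∀ g h a b → adj G T′ (g , 4 ↑ʳ a) (h , 4 ↑ʳ b) ≡ true →
                       parity (toℕ a) ≢ parity (toℕ b)
  new-new-adj-parity g h a b g~h with new-new-adj g h a b g~h
  ... | inj₁ c       = chord-parity a b c
  ... | inj₂ (_ , p) = path-parity a b p

  attach⇒adj : ∀ h l b → T (attach l b) → adj G T′ (h , l ↑ˡ r) (h , 4 ↑ʳ b) ≡ true
  attach⇒adj h l b att = begin
    T′ (l ↑ˡ r) (4 ↑ʳ b) (h · inv h)  ≡⟨ cong-app (T′-old-new l b) (h · inv h) ⟩
    Seg (χ (attach l b)) (h · inv h)  ≡⟨ cong (Seg (χ (attach l b))) (inverseʳ h) ⟩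
    Seg (χ (attach l b)) e            ≡⟨ Seg-e (1≤χ att) ⟩
    true                              ∎

  path⇒adj : ∀ h a b → T (path a b) → adj G T′ (h , 4 ↑ʳ a) (h , 4 ↑ʳ b) ≡ true
  path⇒adj h a b p = trans (cong (T′ (4 ↑ʳ a) (4 ↑ʳ b)) (inverseʳ h)) (e∈T′ (≤-trans (1≤χ p) (m≤m+n _ _)))
    where
    e∈T′ : 1 ≤ weight a b → T′ (4 ↑ʳ a) (4 ↑ʳ b) e ≡ true
    e∈T′ 1≤w with toℕ a <ᵇ toℕ b
    ... | true  = Seg-e 1≤w
    ... | false = trans (cong (Seg (weight a b)) ε⁻¹≈ε) (Seg-e 1≤w)

  new-not-on-triangle : ∀ g a → ¬ HasTriangleThrough G T′ (g , 4 ↑ʳ a)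
  new-not-on-triangle g a ((hu , iu) , (hw , iw) , v≢u , v≢w , u≢w , v~u , u~w , w~v) with part iu | part iw
  ... | new bu | new bw =
    ¬three-distinct-parities _ _ _ (new-new-adj-parity g hu a bu v~u)
                                   (new-new-adj-parity hu hw bu bw u~w)
                                   (new-new-adj-parity hw g bw a w~v)
  ... | old lu | new bw =
    let hu≡g  , a-att  = new-old-adj g hu a lu v~u
        hw≡hu , bw-att = old-new-adj hu hw lu bw u~w
    in v≢w (cong₂ _,_ (sym (trans hw≡hu hu≡g)) (cong (4 ↑ʳ_) (attach-functional lu a-att bw-att)))
  ... | new bu | old lw =
    let g≡hw  , a-att  = old-new-adj hw g lw a w~v
        hw≡hu , bu-att = new-old-adj hu hw bu lw u~w
    in v≢u (cong₂ _,_ (trans g≡hw hw≡hu) (cong (4 ↑ʳ_) (attach-functional lw a-att bu-att)))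
  ... | old lu | old lw =
    let hu≡g , lu-att = new-old-adj g hu a lu v~u
        g≡hw , lw-att = old-new-adj hw g lw a w~v
    in u≢w (cong₂ _,_ (trans hu≡g g≡hw) (cong (_↑ˡ r) (attach-injective lu lw lu-att lw-att)))

  on-triangle⇒old : ∀ {y} → HasTriangleThrough G T′ y → ∃ λ v → ι v ≡ y
  on-triangle⇒old {h , i} triangle with part i
  ... | old l = (h , l) , refl
  ... | new b = ⊥-elim (new-not-on-triangle h b triangle)

  ι-isEmbedding : IsEmbedding T₄ T′ ι
  ι-isEmbedding = record { injective = ι-injective ; adj-ι = adj-ι }
    where
    ι-injective : ∀ {u v} → ι u ≡ ι v → u ≡ v
    ι-injective {g , l} {h , l′} eq = cong₂ _,_ (cong proj₁ eq) (↑ˡ-injective r l l′ (cong proj₂ eq))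
    adj-ι : ∀ u v → adj G T′ (ι u) (ι v) ≡ adj G T₄ u v
    adj-ι (g , l) (h , l′) = cong-app (T′-old-old l l′) (h · inv g)

  IsAut-restrict-old : (∀ v → HasTriangleThrough G T₄ v) → ∀ {f} → IsAut G T′ f →
    Σ (Vertex G 4 → Vertex G 4) λ f₀ → IsAut G T₄ f₀ × (∀ v → f (ι v) ≡ ι (f₀ v))
  IsAut-restrict-old triangle {f} f-aut =
    f₀ , IsAut-restrict ι-isEmbedding {f} {f₀} {f₀′} f-aut f∘ι f⁻¹∘ι , f∘ι
    where
    image-old : ∀ {h} → IsAut G T′ h → ∀ v → ∃ λ v′ → ι v′ ≡ h (ι v)
    image-old h-aut v = on-triangle⇒old (IsEmbedding-triangle (IsAut⇒IsEmbedding {X = T′} h-aut)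
                                                              (IsEmbedding-triangle ι-isEmbedding (triangle v)))
    f₀ f₀′ : Vertex G 4 → Vertex G 4
    f₀  = proj₁ ∘ image-old f-aut
    f₀′ = proj₁ ∘ image-old (IsAut-inverse {X = T′} f-aut)
    f∘ι : ∀ v → f (ι v) ≡ ι (f₀ v)
    f∘ι v = sym (proj₂ (image-old f-aut v))
    f⁻¹∘ι : ∀ v → proj₁ f-aut (ι v) ≡ ι (f₀′ v)
    f⁻¹∘ι v = sym (proj₂ (image-old (IsAut-inverse {X = T′} f-aut) v))

  module _ {f f′} (f-aut : IsAut G T′ f) (f′-aut : IsAut G T′ f′)
           (agree-old : ∀ v → f (ι v) ≡ f′ (ι v)) where

    Agree : Vertex G (4 + r) → Set
    Agree y = f y ≡ f′ y

    NewNeighboursAgree : Vertex G (4 + r) → Vertex G (4 + r) → Set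
    NewNeighboursAgree u v =
      ∀ (h : Fin n) (b : Fin r) → adj G T′ u (h , 4 ↑ʳ b) ≡ true → (h , 4 ↑ʳ b) ≢ v → Agree (h , 4 ↑ʳ b)

    agree-at-new-neighbour : ∀ {u v} → Agree u → adj G T′ u v ≡ true → NewNeighboursAgree u v → Agree v
    agree-at-new-neighbour {u} {v} agree-u u~v agree-new = agree-at-neighbour {X = T′} f-aut f′-aut agree-u u~v others
      where
      others : ∀ w → adj G T′ u w ≡ true → w ≢ v → Agree w
      others (h , i) u~w w≢v with part i
      ... | old l = agree-old (h , l)
      ... | new b = agree-new h b u~w w≢v

    AgreeOuter : ℕ → Set
    AgreeOuter t = ∀ (h : Fin n) (b : Fin r) → Outer r t (toℕ b) → Agree (h , 4 ↑ʳ b)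

    new-vertex-≡ : ∀ {h h′ : Fin n} {b b′ : Fin r} → h ≡ h′ → toℕ b ≡ toℕ b′ →
                   (h , 4 ↑ʳ b) ≡ (h′ , 4 ↑ʳ b′)
    new-vertex-≡ h≡h′ b≡b′ = cong₂ _,_ h≡h′ (cong (4 ↑ʳ_) (toℕ-injective b≡b′))

    agree-left : ∀ t → AgreeOuter t → ∀ h (b : Fin r) → toℕ b ≡ t → Agree (h , 4 ↑ʳ b)
    agree-left zero _ h b b≡0 =
      agree-at-new-neighbour (agree-old (h , 2F)) (attach⇒adj h 2F b (attach-first b≡0)) neighbours
      where
      neighbours : NewNeighboursAgree (h , 2F ↑ˡ r) (h , 4 ↑ʳ b)
      neighbours hw bw u~w w≢v =
        let hw≡h , bw-att = old-new-adj h hw 2F bw u~w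
        in ⊥-elim (w≢v (cong₂ _,_ hw≡h (cong (4 ↑ʳ_) (attach-functional 2F bw-att (attach-first b≡0)))))
    agree-left (suc t) outer h b b≡1+t =
      agree-at-new-neighbour (outer h b₀ (inj₁ (s≤s (≤-reflexive b₀≡t))))
                             (path⇒adj h b₀ b (path-up b₀ b 1+b₀≡b)) neighbours
      where
      t<r : t < r
      t<r = ≤-trans (n≤1+n _) (subst (_< r) b≡1+t (toℕ<n b))
      b₀ : Fin r
      b₀ = fromℕ< t<r
      b₀≡t : toℕ b₀ ≡ t
      b₀≡t = toℕ-fromℕ< t<r
      1+b₀≡b : suc (toℕ b₀) ≡ toℕ b
      1+b₀≡b = trans (cong suc b₀≡t) (sym b≡1+t)
      neighbours : NewNeighboursAgree (h , 4 ↑ʳ b₀) (h , 4 ↑ʳ b)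
      neighbours hw bw u~w w≢v with new-new-adj h hw b₀ bw u~w
      ... | inj₁ c =
        outer hw bw (inj₂ (≤-reflexive (trans (≡ᵇ⇒≡ r _ c) (cong (λ x → suc (x + toℕ bw)) b₀≡t))))
      ... | inj₂ (hw≡h , p) with path-view b₀ bw p
      ...   | inj₁ 1+b₀≡bw = ⊥-elim (w≢v (new-vertex-≡ hw≡h (trans (sym 1+b₀≡bw) 1+b₀≡b)))
      ...   | inj₂ 1+bw≡b₀ = outer hw bw (inj₁ (≤-trans (≤-reflexive (trans 1+bw≡b₀ b₀≡t)) (n≤1+n t)))

    agree-right : ∀ t → AgreeOuter t → ∀ h (b : Fin r) → r ≡ suc (t + toℕ b) → Agree (h , 4 ↑ʳ b)
    agree-right zero _ h b r≡1+b =
      agree-at-new-neighbour (agree-old (h , 3F)) (attach⇒adj h 3F b (attach-last r≡1+b)) neighbours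
      where
      neighbours : NewNeighboursAgree (h , 3F ↑ˡ r) (h , 4 ↑ʳ b)
      neighbours hw bw u~w w≢v =
        let hw≡h , bw-att = old-new-adj h hw 3F bw u~w
        in ⊥-elim (w≢v (cong₂ _,_ hw≡h (cong (4 ↑ʳ_) (attach-functional 3F bw-att (attach-last r≡1+b)))))
    agree-right (suc t) outer h b r≡2+t+b =
      agree-at-new-neighbour (outer h b₁ (inj₂ r≤1+t+b₁)) (path⇒adj h b₁ b (path-down b₁ b (sym b₁≡1+b)))
                             neighbours
      where
      1+b<r : suc (toℕ b) < r
      1+b<r = ≤-trans (s≤s (s≤s (m≤n+m (toℕ b) t))) (≤-reflexive (sym r≡2+t+b))
      b₁ : Fin r
      b₁ = fromℕ< 1+b<r
      b₁≡1+b : toℕ b₁ ≡ suc (toℕ b)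
      b₁≡1+b = toℕ-fromℕ< 1+b<r
      r≤1+t+b₁ : r ≤ suc t + toℕ b₁
      r≤1+t+b₁ =
        ≤-reflexive (trans r≡2+t+b (cong suc (trans (sym (+-suc t (toℕ b))) (cong (t +_) (sym b₁≡1+b)))))
      chord-partner : ∀ bw → r ≡ suc (toℕ b₁ + toℕ bw) → toℕ bw ≡ t
      chord-partner bw r≡1+b₁+bw = +-cancelˡ-≡ (toℕ b) _ _ (suc-injective (suc-injective (begin
        suc (suc (toℕ b + toℕ bw))  ≡⟨ cong (λ x → suc (x + toℕ bw)) b₁≡1+b ⟨
        suc (toℕ b₁ + toℕ bw)       ≡⟨ r≡1+b₁+bw ⟨
        r                           ≡⟨ r≡2+t+b ⟩
        suc (suc (t + toℕ b))       ≡⟨ cong (2 +_) (+-comm t (toℕ b)) ⟩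
        suc (suc (toℕ b + t))       ∎)))
      neighbours : NewNeighboursAgree (h , 4 ↑ʳ b₁) (h , 4 ↑ʳ b)
      neighbours hw bw u~w w≢v with new-new-adj h hw b₁ bw u~w
      ... | inj₁ c = outer hw bw (inj₁ (s≤s (≤-reflexive (chord-partner bw (≡ᵇ⇒≡ r _ c)))))
      ... | inj₂ (hw≡h , p) with path-view b₁ bw p
      ...   | inj₁ 1+b₁≡bw =
        outer hw bw (inj₂ (≤-trans r≤1+t+b₁ (+-monoʳ-≤ (suc t) (≤-trans (n≤1+n _) (≤-reflexive 1+b₁≡bw)))))
      ...   | inj₂ 1+bw≡b₁ = ⊥-elim (w≢v (new-vertex-≡ hw≡h (suc-injective (trans 1+bw≡b₁ b₁≡1+b))))

    agree-outer : ∀ t → AgreeOuter t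
    agree-outer zero    h b (inj₁ ())
    agree-outer zero    h b (inj₂ r≤b) = ⊥-elim (<⇒≱ (toℕ<n b) r≤b)
    agree-outer (suc t) h b outer with Outer-suc outer
    ... | inj₁ outer-t         = agree-outer t h b outer-t
    ... | inj₂ (inj₁ b≡t)      = agree-left t (agree-outer t) h b b≡t
    ... | inj₂ (inj₂ r≡1+t+b)  = agree-right t (agree-outer t) h b r≡1+t+b

    agree-everywhere : f ≗ f′
    agree-everywhere (h , i) with part i
    ... | old l = agree-old (h , l)
    ... | new b = agree-outer r h b (inj₁ (toℕ<n b))

  T′-translations-exhaust : AutIsoG G T₄ → (∀ v → HasTriangleThrough G T₄ v) →
                            ∀ f → IsAut G T′ f → ∃ λ x → f ≗ ρ x
  T′-translations-exhaust iso triangle f f-aut =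
    let f₀ , f₀-aut , f∘ι = IsAut-restrict-old triangle f-aut
        x , f₀≗ρx         = translations-exhaust T₄ iso f₀ f₀-aut
    in x , agree-everywhere f-aut (ρ-isAut T′ x) (λ v → trans (f∘ι v) (cong ι (f₀≗ρx v)))

  hasHGR : IsCayleyMatrix G 4 T₄ → EmptyDiagonal G 4 T₄ → AutIsoG G T₄ →
           (∀ g l → HasTriangleThrough G T₄ (g , l)) →
           (∀ g → valency G T₄ (g , 0F) ≡ suc k × valency G T₄ (g , 1F) ≡ suc k) →
           (∀ g → valency G T₄ (g , 2F) ≡ k × valency G T₄ (g , 3F) ≡ k) →
           HasHGR G (4 + r)
  hasHGR cay empty iso triangle val₀₁ val₂₃ =
    T′ , s≤s (s≤s z≤n) , T′-isCayley cay empty , T′-emptyDiagonal empty , T′-regular val₀₁ val₂₃ ,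
    translations-AutIsoG T′ (T′-translations-exhaust iso (λ v → triangle (proj₁ v) (proj₂ v)))

even-decomposition : ∀ {m} → 2 ∣ m → 6 ≤ m → ∃ λ r → m ≡ 4 + r × 2 ≤ r × parity r ≡ 0ℙ
even-decomposition {m} 2∣m 6≤m =
  m ∸ 4 , sym 4+[m∸4]≡m , ∸-monoˡ-≤ 4 6≤m , trans (cong parity 4+[m∸4]≡m) (even⇒parity≡0ℙ 2∣m)
  where
  4+[m∸4]≡m : 4 + (m ∸ 4) ≡ m
  4+[m∸4]≡m = m+[n∸m]≡n (≤-trans (m≤m+n 4 2) 6≤m)

lemma2p3 : (G : FinGroup) (T : Matrix G 4) (k : ℕ) →
    IsPGSR G 4 T →
    2 ≤ k → k ≤ FinGroup.order G →
    ((g : Fin (FinGroup.order G)) →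
       (valency G T (g , zero) ≡ suc k) × (valency G T (g , suc zero) ≡ suc k)) →
    ((g : Fin (FinGroup.order G)) →
       (valency G T (g , suc (suc zero)) ≡ k) × (valency G T (g , suc (suc (suc zero))) ≡ k)) →
    ((g : Fin (FinGroup.order G)) (i : Fin 4) → HasTriangleThrough G T (g , i)) →
    (m : ℕ) → 2 ∣ m → 6 ≤ m → HasHGR G m
lemma2p3 G T k (cay , empty , iso) 2≤k k≤n val₀₁ val₂₃ triangle m 2∣m 6≤m
  with r , refl , 2≤r , r-even ← even-decomposition 2∣m 6≤m =
  Extension.hasHGR G T k r (≤-trans (s≤s z≤n) 2≤k) k≤n 2≤r r-even cay empty iso triangle val₀₁ val₂₃
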